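{- Let $d\ge1$ and let $H_1,\dots,H_d$ be finite undirected graphs on a common vertex set $V$, and let $G$ be their intersection, i.e. $V(G)=V$ and $E(G)=\bigcap_{i=1}^d E(H_i)$. Then $s(G)<R(s(H_1)+1,s(H_2)+1,\dots,s(H_d)+1)$.
   Context: $s(H)$ denotes the number of leaves of a largest induced star (induced subgraph isomorphic to $K_{1,s}$) in $H$; when $|V(H)|\le 2$, $s(H)=1$ by convention. $R(n_1,\dots,n_c)$ is the multicolor Ramsey number: the least $t$ such that every coloring of the edges of $K_t$ with colors $1,\dots,c$ contains, for some $i$, a complete subgraph on $n_i$ vertices all of whose edges have color $i$. -}

module Defs where

open import Data.Nat using (ℕ; suc; _≤_; _<_)
open import Data.Fin using (Fin)
open import Data.Product using (Σ; _×_; ∃)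
open import Data.Sum using (_⊎_)
open import Relation.Binary.PropositionalEquality using (_≡_)
open import Relation.Nullary using (¬_)
open import Function.Definitions using (Injective)

record Graph (n : ℕ) : Set₁ where
  field
    Adj     : Fin n → Fin n → Set
    sym     : ∀ {u v} → Adj u v → Adj v u
    irrefl  : ∀ {u} → ¬ Adj u u
open Graph public

intersection : ∀ {n d} → (Fin (suc d) → Graph n) → Graph n
intersection {n} {d} H = record
  { Adj    = λ u v → (i : Fin (suc d)) → Adj (H i) u v
  ; sym    = λ a i → sym (H i) (a i)
  ; irrefl = λ a → irrefl (H Data.Fin.zero) (a Data.Fin.zero)
  }

InducedStar : ∀ {n} → Graph n → ℕ → Set
InducedStar {n} H k =
  Σ (Fin n) λ c → Σ (Fin k → Fin n) λ f →
    Injective _≡_ _≡_ f ×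
    ((j : Fin k) → ¬ (f j ≡ c)) ×
    ((j : Fin k) → Adj H c (f j)) ×
    ((j j' : Fin k) → ¬ Adj H (f j) (f j'))

-- IsStarNumber H k  :⇔  s(H) = k
-- (convention: s(H) = 1 if |V(H)| ≤ 2; otherwise the maximum number of
--  leaves of an induced star).
IsStarNumber : ∀ {n} → Graph n → ℕ → Set
IsStarNumber {n} H k =
  (n ≤ 2 × k ≡ 1) ⊎
  (2 < n × InducedStar H k × (∀ m → InducedStar H m → m ≤ k))

-- A c-colouring of the edges of K_t (value on the diagonal irrelevant).
record Colouring (c t : ℕ) : Set where
  field
    col     : Fin t → Fin t → Fin c
    col-sym : ∀ u v → col u v ≡ col v u
open Colouring public

MonoClique : ∀ {c t} → Colouring c t → Fin c → ℕ → Set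
MonoClique {c} {t} χ i m =
  Σ (Fin m → Fin t) λ g → Injective _≡_ _≡_ g ×
    ((a b : Fin m) → ¬ (a ≡ b) → col χ (g a) (g b) ≡ i)

RamseyProperty : (c : ℕ) → (Fin c → ℕ) → ℕ → Set
RamseyProperty c ns t = (χ : Colouring c t) → ∃ λ i → MonoClique χ i (ns i)

IsRamseyNumber : (c : ℕ) → (Fin c → ℕ) → ℕ → Set
IsRamseyNumber c ns r =
  RamseyProperty c ns r × (∀ t → t < r → ¬ RamseyProperty c ns t)

-- Colour each pair of leaves of an induced star of G by an index i for which
-- the two leaves are non-adjacent in H_i; such an i exists because they are
-- non-adjacent in G.  If the star had R(s(H_1)+1, …, s(H_d)+1) leaves, a
-- monochromatic clique of colour i would be the leaf set of an induced star
-- of H_i with s(H_i)+1 leaves.  Adjacency need not be decidable, but the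
-- conclusion is, so decidability of the finitely many adjacencies may be
-- assumed under a double negation.
module Submission where

open import Defs
open import Data.Nat using (ℕ; zero; suc; _<_; _≤_)
open import Data.Nat.Properties using (_<?_; ≰⇒>; 1+n≰n; <⇒≱)
open import Data.Fin using (Fin; inject≤; _≟_) renaming (zero to fzero; suc to fsuc)
open import Data.Fin.Properties using (inject≤-injective; injective⇒≤; ∀-cons)
open import Data.Product using (∃; _,_)
open import Data.Sum using (inj₁; inj₂)
open import Function using (_∘_)
open import Relation.Nullary using (¬_; Dec; yes; no; contradiction)
open import Relation.Nullary.Decidable using (decidable-stable; ¬¬-excluded-middle)
open import Relation.Nullary.Negation using (¬¬-map)
open import Relation.Binary.PropositionalEquality using (_≡_; refl; cong; subst; trans) renaming (sym to ≡-sym)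

¬¬-Π : ∀ {k} {P : Fin k → Set} → (∀ i → ¬ ¬ P i) → ¬ ¬ (∀ i → P i)
¬¬-Π {zero}  _    ¬all = ¬all λ ()
¬¬-Π {suc k} ¬¬P ¬all =
  ¬¬P fzero λ p₀ → ¬¬-Π (¬¬P ∘ fsuc) λ ps → ¬all (∀-cons p₀ ps)

¬¬-adjacency-decidable : ∀ {n d} (H : Fin d → Graph n) →
  ¬ ¬ (∀ i u v → Dec (Adj (H i) u v))
¬¬-adjacency-decidable H =
  ¬¬-Π λ i → ¬¬-Π λ u → ¬¬-Π λ v → ¬¬-excluded-middle

firstFailure : ∀ {k} {P : Fin (suc k) → Set} → (∀ i → Dec (P i)) → Fin (suc k)
firstFailure {zero}  P? = fzero
firstFailure {suc k} P? with P? fzero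
... | no  _ = fzero
... | yes _ = fsuc (firstFailure (P? ∘ fsuc))

firstFailure-fails : ∀ {k} {P : Fin (suc k) → Set} (P? : ∀ i → Dec (P i)) →
  ¬ (∀ i → P i) → ¬ P (firstFailure P?)
firstFailure-fails {zero}  P? ¬all p = ¬all λ { fzero → p }
firstFailure-fails {suc k} P? ¬all with P? fzero
... | no  ¬p₀ = ¬p₀
... | yes p₀  = firstFailure-fails (P? ∘ fsuc) (¬all ∘ ∀-cons p₀)

firstFailure-cong : ∀ {k} {P Q : Fin (suc k) → Set}
  (P? : ∀ i → Dec (P i)) (Q? : ∀ i → Dec (Q i)) →
  (∀ i → P i → Q i) → (∀ i → Q i → P i) → firstFailure P? ≡ firstFailure Q?
firstFailure-cong {zero}  P? Q? P⇒Q Q⇒P = refl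
firstFailure-cong {suc k} P? Q? P⇒Q Q⇒P with P? fzero | Q? fzero
... | no  _  | no  _  = refl
... | yes p₀ | no ¬q₀ = contradiction (P⇒Q fzero p₀) ¬q₀
... | no ¬p₀ | yes q₀ = contradiction (Q⇒P fzero q₀) ¬p₀
... | yes _  | yes _  =
  cong fsuc (firstFailure-cong (P? ∘ fsuc) (Q? ∘ fsuc) (P⇒Q ∘ fsuc) (Q⇒P ∘ fsuc))

InducedStar-≤ : ∀ {n} {H : Graph n} {k m} → m ≤ k → InducedStar H k → InducedStar H m
InducedStar-≤ {k = k} {m} m≤k (c , f , f-inj , f≢c , c~f , f≁f) =
  c , f ∘ inject , inject≤-injective m≤k m≤k _ _ ∘ f-inj ,
  f≢c ∘ inject , c~f ∘ inject , (λ j j' → f≁f (inject j) (inject j'))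
  where
  inject : Fin m → Fin k
  inject j = inject≤ j m≤k

IsStarNumber-small : ∀ {n} {H : Graph n} {s} → IsStarNumber H s → n ≤ 2 → s ≡ 1
IsStarNumber-small (inj₁ (_ , s≡1))   _   = s≡1
IsStarNumber-small (inj₂ (2<n , _)) n≤2 = contradiction n≤2 (<⇒≱ 2<n)

IsStarNumber-maximal : ∀ {n} {H : Graph n} {s m} → IsStarNumber H s → 2 < n →
  InducedStar H m → m ≤ s
IsStarNumber-maximal (inj₁ (n≤2 , _))         2<n _    = contradiction n≤2 (<⇒≱ 2<n)
IsStarNumber-maximal (inj₂ (_ , _ , maximal)) _   star = maximal _ star

constantColouring : ∀ {c t} → Fin c → Colouring c t
constantColouring i = record { col = λ _ _ → i ; col-sym = λ _ _ → refl }

RamseyProperty⇒∃≤ : ∀ {c} {ns : Fin (suc c) → ℕ} {t} →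
  RamseyProperty (suc c) ns t → ∃ λ i → ns i ≤ t
RamseyProperty⇒∃≤ ramsey with ramsey (constantColouring fzero)
... | i , g , g-inj , _ = i , injective⇒≤ g-inj

module _ {n d} (H : Fin (suc d) → Graph n) (adj? : ∀ i u v → Dec (Adj (H i) u v)) where

  -- The least index, not an arbitrary one, so that the colouring is symmetric.
  missingEdgeIndex : Fin n → Fin n → Fin (suc d)
  missingEdgeIndex u v = firstFailure (λ i → adj? i u v)

  missingEdgeIndex-sym : ∀ u v → missingEdgeIndex u v ≡ missingEdgeIndex v u
  missingEdgeIndex-sym u v =
    firstFailure-cong (λ i → adj? i u v) (λ i → adj? i v u) (λ i → sym (H i)) (λ i → sym (H i))

  missingEdgeColouring : ∀ {t} → (Fin t → Fin n) → Colouring (suc d) t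
  missingEdgeColouring f = record
    { col     = λ a b → missingEdgeIndex (f a) (f b)
    ; col-sym = λ a b → missingEdgeIndex-sym (f a) (f b)
    }

  RamseyProperty⇒componentStar : ∀ {t} (ns : Fin (suc d) → ℕ) →
    RamseyProperty (suc d) ns t → InducedStar (intersection H) t →
    ∃ λ i → InducedStar (H i) (ns i)
  RamseyProperty⇒componentStar ns ramsey (c , f , f-inj , f≢c , c~f , f≁f)
    with ramsey (missingEdgeColouring f)
  ... | i , g , g-inj , g-mono =
    i , c , f ∘ g , g-inj ∘ f-inj , f≢c ∘ g , (λ j → c~f (g j) i) , leaves≁
    where
    leaves≁ : ∀ j j' → ¬ Adj (H i) (f (g j)) (f (g j'))
    leaves≁ j j' with j ≟ j'
    ... | yes refl = irrefl (H i)
    ... | no  j≢j' = subst (λ k → ¬ Adj (H k) (f (g j)) (f (g j'))) (g-mono j j' j≢j')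
                       (firstFailure-fails (λ k → adj? k (f (g j)) (f (g j'))) (f≁f (g j) (g j')))

theorem2p2 : ∀ {n d} (H : Fin (suc d) → Graph n)
    (sH : Fin (suc d) → ℕ) → (∀ i → IsStarNumber (H i) (sH i)) →
    (sG : ℕ) → IsStarNumber (intersection H) sG →
    (r : ℕ) → IsRamseyNumber (suc d) (λ i → suc (sH i)) r →
    sG < r
theorem2p2 H sH isH sG isG r (ramsey , _) =
  decidable-stable (sG <? r) (¬¬-map (sG<r isG) (¬¬-adjacency-decidable H))
  where
  sG<r : IsStarNumber (intersection H) sG → (∀ i u v → Dec (Adj (H i) u v)) → sG < r
  sG<r (inj₁ (n≤2 , sG≡1)) _ =
    let i , 1+sHᵢ≤r = RamseyProperty⇒∃≤ ramsey
        sHᵢ≡sG = trans (IsStarNumber-small {H = H i} (isH i) n≤2) (≡-sym sG≡1)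
    in subst (λ s → suc s ≤ r) sHᵢ≡sG 1+sHᵢ≤r
  sG<r (inj₂ (2<n , star , _)) adj? = ≰⇒> λ r≤sG →
    let i , starᵢ = RamseyProperty⇒componentStar H adj? _ ramsey
                      (InducedStar-≤ {H = intersection H} r≤sG star)
    in 1+n≰n (IsStarNumber-maximal {H = H i} (isH i) 2<n starᵢ)
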